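{- Consider the two-way unsplittable trading problem with known price range $[m,M]$, $0<m<M$, fluctuation ratio $\varphi=M/m$, and at most $k=1$ trade. For every $\epsilon>0$, no deterministic online algorithm has competitive ratio smaller than $\varphi^{1-\epsilon}$; that is, for every deterministic online algorithm there is a price sequence with all prices in $[m,M]$ on which the ratio of the optimal offline return to the algorithm's return is at least $\varphi^{1-\epsilon}$.
   Context: Two-way unsplittable trading problem: a sequence of prices $p(1),p(2),\ldots,p(T)$ (positive reals), one per day, is revealed online; the horizon length $T$ is not known to the online algorithm in advance, but when day $i$ arrives the algorithm learns whether $i=T$. The investor starts with cash and may make at most $k$ trades. A trade is a pair of days $(b,s)$ with $b<s$: on day $b$ all available money is used to buy the stock at price $p(b)$, and on day $s$ all stock held is sold at price $p(s)$. Trades cannot overlap (a sale must happen before the next purchase), there is no short selling, no buying is allowed on the last day $T$, and any stock still held on day $T$ must be sold at price $p(T)$. The gain of a trade $(b,s)$ is $p(s)/p(b)$, and the return of a sequence of trades is the product of their gains (the return is $1$ if no trade is made). The optimal offline algorithm OPT knows the whole sequence and makes at most $k$ trades maximizing the return. The competitive ratio of an online algorithm ONL is the supremum, over all admissible price sequences, of (return of OPT)/(return of ONL). In this model, all prices lie in $[m,M]$ and $m$ and $M$ are known to the online algorithm in advance.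
   Formalization: The bounds m and M and the parameter ε range over the rationals, and the prices are taken in the rationals rather than in the positive reals. -}

module Defs where

open import Data.Bool using (Bool; true; false; if_then_else_)
open import Data.Nat using (ℕ; zero; suc)
import Data.Nat as ℕ
open import Data.Fin using (Fin; toℕ)
open import Data.List using (List; []; _∷_; _++_; [_]; length; lookup)
open import Data.Maybe using (Maybe; just; nothing)
open import Data.Product using (_×_; _,_)
open import Data.Unit using (⊤)
open import Data.Rational using (ℚ; 0ℚ; 1ℚ; _*_; _÷_; _≟_; ≢-nonZero)
open import Relation.Nullary using (yes; no)

_^_ : ℚ → ℕ → ℚ
x ^ zero  = 1ℚ
x ^ suc n = x * (x ^ n)

-- Total division on ℚ (x / 0 := 0); only ever applied to positive divisors.
_÷'_ : ℚ → ℚ → ℚ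
p ÷' q with q ≟ 0ℚ
... | yes _  = 0ℚ
... | no q≢0 = _÷_ p q {{≢-nonZero q≢0}}

gain : ℚ → ℚ → ℚ
gain b s = s ÷' b

InRange : ℚ → ℚ → ℚ → Set
InRange m M x = (m Data.Rational.≤ x) × (x Data.Rational.≤ M)

-- On day i the algorithm is given the prices p(1),…,p(i) seen so far (in
-- order) and a flag telling whether i = T, and answers whether to trade
-- today: "true" means buy (with all money) if it currently holds cash,
-- and sell (all stock) if it currently holds stock.  Its own past actions
-- are a deterministic function of past inputs, so this is fully general.
Alg : Set
Alg = List ℚ → Bool → Bool

-- Arguments: number of trades still allowed to be opened,
-- current position (nothing = cash, just b = stock bought at price b),
-- prices seen before today, prices from today on.
-- Rules: no buying on the last day T, no buying when k trades were used,
-- and stock still held on day T is sold at p(T).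
run : Alg → ℕ → Maybe ℚ → List ℚ → List ℚ → ℚ
run A k pos seen [] = 1ℚ
run A k nothing seen (x ∷ []) = 1ℚ
run A k (just b) seen (x ∷ []) = gain b x
run A zero nothing seen (x ∷ y ∷ r) = run A zero nothing (seen ++ [ x ]) (y ∷ r)
run A (suc k) nothing seen (x ∷ y ∷ r) =
  if A (seen ++ [ x ]) false
  then run A k (just x) (seen ++ [ x ]) (y ∷ r)
  else run A (suc k) nothing (seen ++ [ x ]) (y ∷ r)
run A k (just b) seen (x ∷ y ∷ r) =
  if A (seen ++ [ x ]) false
  then gain b x * run A k nothing (seen ++ [ x ]) (y ∷ r)
  else run A k (just b) (seen ++ [ x ]) (y ∷ r)

onlineReturn : ℕ → Alg → List ℚ → ℚ
onlineReturn k A ps = run A k nothing [] ps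

-- Offline trade schedules: lists of trades (b , s) of days (indices into
-- the price sequence), with b < s, and each sale strictly before the next
-- purchase.
Schedule : List ℚ → Set
Schedule ps = List (Fin (length ps) × Fin (length ps))

ValidFrom : ∀ {n} → ℕ → List (Fin n × Fin n) → Set
ValidFrom lo [] = ⊤
ValidFrom lo ((b , s) ∷ r) =
  (lo ℕ.≤ toℕ b) × (toℕ b ℕ.< toℕ s) × ValidFrom (suc (toℕ s)) r

ValidSchedule : ∀ {n} → List (Fin n × Fin n) → Set
ValidSchedule σ = ValidFrom 0 σ

scheduleReturn : (ps : List ℚ) → Schedule ps → ℚ
scheduleReturn ps [] = 1ℚ
scheduleReturn ps ((b , s) ∷ r) = gain (lookup ps b) (lookup ps s) * scheduleReturn ps r

-- "ratio ≥ φ^(1 - a/b)" for b > 0 and positive quantities, written without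
-- real exponents:  φ^b ≤ ratio^b · φ^a.
AtLeastPow : ℚ → ℕ → ℕ → ℚ → Set
AtLeastPow φ a b ratio = (φ ^ b) Data.Rational.≤ ((ratio ^ b) * (φ ^ a))

-- Pick a growth factor ρ = 1 + h > 1 so small
-- that ρ^b ≤ φ.  The ladder of prices rung k = min (m ρ^k, M) climbs from
-- rung 0 = m to rung N = M with consecutive ratios at most ρ.  The
-- adversary walks the ladder downward, offering
--   rung N, M, rung (N-1), M, …, rung 0, M, M.
-- If the algorithm buys at some price p, the next and last price is m, so
-- it earns m / p, while the optimum earns M / q for some q ≤ ρ p: it stays
-- in cash (q = M) when p is M or the top rung, and otherwise it bought at
-- the rung q just above p and sold at the M offered in between.  If the
-- algorithm never buys, the optimum buys at rung 0 = m and sells at M.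
-- In every case φ ≤ (OPT / ONL) · ρ, and with ρ^b ≤ φ this gives
-- (OPT / ONL)^b · φ^a ≥ φ^b, i.e. OPT / ONL ≥ φ^(1 - a/b).
module Submission where

open import Defs
open import Data.Bool using (true; false)
open import Data.Empty using (⊥-elim)
open import Data.Fin using (Fin; toℕ) renaming (zero to fzero; suc to fsuc)
import Data.Integer as ℤ
import Data.Integer.Properties as ℤP
open import Data.List using (List; []; _∷_; _++_; [_]; length; lookup)
open import Data.List.Properties using (++-assoc)
open import Data.List.Relation.Unary.All using (All; []; _∷_)
open import Data.List.Relation.Unary.All.Properties using (++⁺)
open import Data.Maybe using (just; nothing)
open import Data.Nat using (ℕ; zero; suc; z≤n; s≤s)
import Data.Nat as ℕ
open import Data.Product using (Σ; _×_; _,_; proj₁; proj₂)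
import Data.Product as Product
open import Data.Rational using (ℚ; 0ℚ; 1ℚ; _+_; _-_; _*_; _≤_; _<_; _⊓_; mkℚ; toℚᵘ; 1/_)
import Data.Rational as Q
import Data.Rational.Properties as QP
import Data.Rational.Unnormalised as U
import Data.Rational.Unnormalised.Properties as UP
open import Data.Rational.Solver using (module +-*-Solver)
open import Data.Unit using (tt)
open import Relation.Binary.PropositionalEquality using (_≡_; refl; sym; trans; cong; cong₂; subst; subst₂; module ≡-Reasoning)
open import Relation.Nullary using (yes; no)

open +-*-Solver using (solve; _:=_; _:+_; _:*_; _:-_; con)

*-monoˡ-≤ : ∀ {r p q} → 0ℚ ≤ r → p ≤ q → r * p ≤ r * q
*-monoˡ-≤ {r} 0≤r = QP.*-monoˡ-≤-nonNeg r {{Q.nonNegative 0≤r}}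

*-monoʳ-≤ : ∀ {r p q} → 0ℚ ≤ r → p ≤ q → p * r ≤ q * r
*-monoʳ-≤ {r} 0≤r = QP.*-monoʳ-≤-nonNeg r {{Q.nonNegative 0≤r}}

*-nonNeg : ∀ {p q} → 0ℚ ≤ p → 0ℚ ≤ q → 0ℚ ≤ p * q
*-nonNeg {p} {q} 0≤p 0≤q = QP.nonNegative⁻¹ (p * q)
  {{QP.nonNeg*nonNeg⇒nonNeg p {{Q.nonNegative 0≤p}} q {{Q.nonNegative 0≤q}}}}

*-pos : ∀ {p q} → 0ℚ < p → 0ℚ < q → 0ℚ < p * q
*-pos {p} {q} 0<p 0<q = QP.positive⁻¹ (p * q)
  {{QP.pos*pos⇒pos p {{Q.positive 0<p}} q {{Q.positive 0<q}}}}

0<1 : 0ℚ < 1ℚ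
0<1 = QP.positive⁻¹ 1ℚ

0≤1 : 0ℚ ≤ 1ℚ
0≤1 = QP.<⇒≤ 0<1

≤-+-nonNeg : ∀ x {y} → 0ℚ ≤ y → x ≤ x + y
≤-+-nonNeg x 0≤y = QP.≤-trans (QP.≤-reflexive (sym (QP.+-identityʳ x))) (QP.+-monoʳ-≤ x 0≤y)

≤-*-≥1 : ∀ {r x} → 1ℚ ≤ r → 0ℚ ≤ x → x ≤ r * x
≤-*-≥1 {r} {x} 1≤r 0≤x = QP.≤-trans (QP.≤-reflexive (sym (QP.*-identityˡ x))) (*-monoʳ-≤ 0≤x 1≤r)

module _ {q : ℚ} (0<q : 0ℚ < q) where

  private instance
    q≢0 : Q.NonZero q
    q≢0 = QP.pos⇒nonZero q {{Q.positive 0<q}}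

  ÷'-unfold : ∀ p → p ÷' q ≡ p * 1/ q
  ÷'-unfold p with q Q.≟ 0ℚ
  ... | yes q≡0 = ⊥-elim (QP.<-irrefl (sym q≡0) 0<q)
  ... | no _    = refl

  1/-pos : 0ℚ < 1/ q
  1/-pos = QP.positive⁻¹ (1/ q) {{QP.1/pos⇒pos q {{Q.positive 0<q}}}}

  ÷'-*-cancel : ∀ p → (p ÷' q) * q ≡ p
  ÷'-*-cancel p = begin
    (p ÷' q) * q   ≡⟨ cong (_* q) (÷'-unfold p) ⟩
    p * 1/ q * q   ≡⟨ QP.*-assoc p (1/ q) q ⟩
    p * (1/ q * q) ≡⟨ cong (p *_) (QP.*-inverseˡ q) ⟩
    p * 1ℚ         ≡⟨ QP.*-identityʳ p ⟩
    p              ∎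
    where open ≡-Reasoning

  ÷'-nonNeg : ∀ {p} → 0ℚ ≤ p → 0ℚ ≤ p ÷' q
  ÷'-nonNeg {p} 0≤p = subst (0ℚ ≤_) (sym (÷'-unfold p)) (*-nonNeg 0≤p (QP.<⇒≤ 1/-pos))

  ÷'-pos : ∀ {p} → 0ℚ < p → 0ℚ < p ÷' q
  ÷'-pos {p} 0<p = subst (0ℚ <_) (sym (÷'-unfold p)) (*-pos 0<p 1/-pos)

^-nonNeg : ∀ {x} n → 0ℚ ≤ x → 0ℚ ≤ x ^ n
^-nonNeg zero    _   = 0≤1
^-nonNeg (suc n) 0≤x = *-nonNeg 0≤x (^-nonNeg n 0≤x)

^-mono-≤ : ∀ {x y} n → 0ℚ ≤ x → x ≤ y → x ^ n ≤ y ^ n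
^-mono-≤ zero    _   _   = QP.≤-refl
^-mono-≤ (suc n) 0≤x x≤y = QP.≤-trans (*-monoˡ-≤ 0≤x (^-mono-≤ n 0≤x x≤y))
  (*-monoʳ-≤ (^-nonNeg n (QP.≤-trans 0≤x x≤y)) x≤y)

^-distrib-* : ∀ x y n → (x * y) ^ n ≡ x ^ n * y ^ n
^-distrib-* x y zero    = sym (QP.*-identityˡ 1ℚ)
^-distrib-* x y (suc n) = trans (cong ((x * y) *_) (^-distrib-* x y n))
  (solve 4 (λ x y u v → (x :* y) :* (u :* v) := (x :* u) :* (y :* v)) refl x y (x ^ n) (y ^ n))

1≤^ : ∀ {x} n → 1ℚ ≤ x → 1ℚ ≤ x ^ n
1≤^ zero    _   = QP.≤-refl
1≤^ (suc n) 1≤x = QP.≤-trans (1≤^ n 1≤x) (≤-*-≥1 1≤x (QP.≤-trans 0≤1 (1≤^ n 1≤x)))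

-- The natural numbers inside ℚ, built by repeated addition of 1 so that
-- induction on n matches the recursion of _^_.
ι : ℕ → ℚ
ι zero    = 0ℚ
ι (suc n) = 1ℚ + ι n

ι-nonNeg : ∀ n → 0ℚ ≤ ι n
ι-nonNeg zero    = QP.≤-refl
ι-nonNeg (suc n) = QP.≤-trans (ι-nonNeg n) (QP.≤-trans (QP.≤-reflexive (sym (QP.+-identityˡ (ι n))))
  (QP.+-monoˡ-≤ (ι n) 0≤1))

ι-toℚᵘ : ∀ n → toℚᵘ (ι n) U.≃ U.mkℚᵘ (ℤ.+ n) 0
ι-toℚᵘ zero    = UP.≃-refl
ι-toℚᵘ (suc n) = UP.≃-trans (QP.toℚᵘ-homo-+ 1ℚ (ι n))
  (UP.≃-trans (UP.+-congʳ (toℚᵘ 1ℚ) (ι-toℚᵘ n)) (U.*≡* (cong (ℤ._* ℤ.1ℤ) (one+n (ℤ.+ n)))))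
  where
  one+n : ∀ i → ℤ.1ℤ ℤ.* ℤ.1ℤ ℤ.+ i ℤ.* ℤ.1ℤ ≡ ℤ.1ℤ ℤ.+ i
  one+n i = cong (λ j → ℤ.1ℤ ℤ.+ j) (ℤP.*-identityʳ i)

archimedean : ∀ q → Σ ℕ (λ n → q ≤ ι n)
archimedean q@(mkℚ ℤ.-[1+ _ ] _ _) = 0 , QP.<⇒≤ (QP.negative⁻¹ q)
archimedean (mkℚ (ℤ.+ n) _ _)      = n , QP.toℚᵘ-cancel-≤ (UP.≤-respʳ-≃ (UP.≃-sym (ι-toℚᵘ n))
  (U.*≤* (ℤP.*-monoˡ-≤-nonNeg (ℤ.+ n) (ℤ.+≤+ (s≤s z≤n)))))

-- Bernoulli's inequality: (1 + h)^k ≥ 1 + k h for h ≥ 0.  It makes the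
-- geometric ladder reach the top of the price range in finitely many steps.
bernoulli : ∀ {h} k → 0ℚ ≤ h → 1ℚ + ι k * h ≤ (1ℚ + h) ^ k
bernoulli {h} zero _ = QP.≤-reflexive (trans (cong (1ℚ +_) (QP.*-zeroˡ h)) (QP.+-identityʳ 1ℚ))
bernoulli {h} (suc k) 0≤h = begin
  1ℚ + (1ℚ + ι k) * h ≡⟨ solve 2 (λ i h → con 1ℚ :+ (con 1ℚ :+ i) :* h := (con 1ℚ :+ i :* h) :+ h) refl (ι k) h ⟩
  (1ℚ + ι k * h) + h  ≤⟨ QP.+-mono-≤ (bernoulli k 0≤h) (QP.≤-trans (QP.≤-reflexive (sym (QP.*-identityʳ h)))
                          (*-monoˡ-≤ 0≤h (1≤^ k (≤-+-nonNeg 1ℚ 0≤h)))) ⟩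
  P + h * P           ≡⟨ solve 2 (λ h P → P :+ h :* P := (con 1ℚ :+ h) :* P) refl h P ⟩
  (1ℚ + h) * P        ∎
  where
  open QP.≤-Reasoning
  P = (1ℚ + h) ^ k

-- A converse estimate: (1 + h)^k ≤ 1 + k h φ^k whenever 0 ≤ h and
-- 1 + h ≤ φ.  It shows that ρ = 1 + h satisfies ρ^b ≤ φ once h is small.
bernoulli-reverse : ∀ {h φ} k → 0ℚ ≤ h → 1ℚ + h ≤ φ → (1ℚ + h) ^ k ≤ 1ℚ + ι k * (h * φ ^ k)
bernoulli-reverse {h} {φ} zero _ _ =
  QP.≤-reflexive (sym (trans (cong (1ℚ +_) (QP.*-zeroˡ (h * 1ℚ))) (QP.+-identityʳ 1ℚ)))
bernoulli-reverse {h} {φ} (suc k) 0≤h ρ≤φ = begin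
  (1ℚ + h) * P                          ≡⟨ solve 2 (λ h P → (con 1ℚ :+ h) :* P := P :+ h :* P) refl h P ⟩
  P + h * P                             ≤⟨ QP.+-mono-≤ (bernoulli-reverse k 0≤h ρ≤φ)
                                             (*-monoˡ-≤ 0≤h (^-mono-≤ k 0≤ρ ρ≤φ)) ⟩
  (1ℚ + ι k * (h * F)) + h * F          ≤⟨ QP.+-mono-≤ (QP.+-monoʳ-≤ 1ℚ (*-monoˡ-≤ (ι-nonNeg k) (*-monoˡ-≤ 0≤h F≤φF)))
                                             (*-monoˡ-≤ 0≤h F≤φF) ⟩
  (1ℚ + ι k * (h * (φ * F))) + h * (φ * F)
    ≡⟨ solve 3 (λ i h G → (con 1ℚ :+ i :* (h :* G)) :+ h :* G := con 1ℚ :+ (con 1ℚ :+ i) :* (h :* G)) refl (ι k) h (φ * F) ⟩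
  1ℚ + (1ℚ + ι k) * (h * (φ * F))       ∎
  where
  open QP.≤-Reasoning
  P = (1ℚ + h) ^ k
  F = φ ^ k
  1≤ρ : 1ℚ ≤ 1ℚ + h
  1≤ρ = ≤-+-nonNeg 1ℚ 0≤h
  0≤ρ : 0ℚ ≤ 1ℚ + h
  0≤ρ = QP.≤-trans 0≤1 1≤ρ
  1≤φ : 1ℚ ≤ φ
  1≤φ = QP.≤-trans 1≤ρ ρ≤φ
  F≤φF : F ≤ φ * F
  F≤φF = ≤-*-≥1 1≤φ (^-nonNeg k (QP.≤-trans 0≤1 1≤φ))

atLeastPow-intro : ∀ {φ ρ R} a b → 0 ℕ.< a → 1ℚ ≤ φ → ρ ^ b ≤ φ → 0ℚ ≤ R → φ ≤ R * ρ →
                   AtLeastPow φ a b R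
atLeastPow-intro {φ} {ρ} {R} (suc a) b _ 1≤φ ρᵇ≤φ 0≤R φ≤Rρ = begin
  φ ^ b           ≤⟨ ^-mono-≤ b 0≤φ φ≤Rρ ⟩
  (R * ρ) ^ b     ≡⟨ ^-distrib-* R ρ b ⟩
  R ^ b * ρ ^ b   ≤⟨ *-monoˡ-≤ (^-nonNeg b 0≤R) ρᵇ≤φ ⟩
  R ^ b * φ       ≤⟨ *-monoˡ-≤ (^-nonNeg b 0≤R) φ≤φ^[1+a] ⟩
  R ^ b * φ ^ suc a ∎
  where
  open QP.≤-Reasoning
  0≤φ : 0ℚ ≤ φ
  0≤φ = QP.≤-trans 0≤1 1≤φ
  φ≤φ^[1+a] : φ ≤ φ * φ ^ a
  φ≤φ^[1+a] = QP.≤-trans (QP.≤-reflexive (sym (QP.*-identityʳ φ))) (*-monoˡ-≤ 0≤φ (1≤^ a 1≤φ))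

module Simulation (A : Alg) where

  decline : ∀ {s x} z r → A (s ++ [ x ]) false ≡ false →
            run A 1 nothing s (x ∷ z ∷ r) ≡ run A 1 nothing (s ++ [ x ]) (z ∷ r)
  decline z r e rewrite e = refl

  buy : ∀ {s x} z r → A (s ++ [ x ]) false ≡ true →
        run A 1 nothing s (x ∷ z ∷ r) ≡ run A 0 (just x) (s ++ [ x ]) (z ∷ r)
  buy z r e rewrite e = refl

  -- A history s is idle for A if A declined every price of s: on any
  -- sequence starting with s and lasting at least two more days, the run
  -- reaches the end of s still holding cash and its one trade.
  Idle : List ℚ → Set
  Idle s = ∀ u v r → onlineReturn 1 A (s ++ u ∷ v ∷ r) ≡ run A 1 nothing s (u ∷ v ∷ r)

  idle-[] : Idle []
  idle-[] u v r = refl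

  idle-extend : ∀ {s x} → Idle s → A (s ++ [ x ]) false ≡ false → Idle (s ++ [ x ])
  idle-extend {s} {x} idle e u v r = begin
    onlineReturn 1 A ((s ++ [ x ]) ++ u ∷ v ∷ r) ≡⟨ cong (onlineReturn 1 A) (++-assoc s [ x ] (u ∷ v ∷ r)) ⟩
    onlineReturn 1 A (s ++ x ∷ u ∷ v ∷ r)        ≡⟨ idle x u (v ∷ r) ⟩
    run A 1 nothing s (x ∷ u ∷ v ∷ r)            ≡⟨ decline u (v ∷ r) e ⟩
    run A 1 nothing (s ++ [ x ]) (u ∷ v ∷ r)     ∎
    where open ≡-Reasoning

tradeAfter : (xs : List ℚ) {u v : ℚ} {r : List ℚ} →
             Fin (length (xs ++ u ∷ v ∷ r)) × Fin (length (xs ++ u ∷ v ∷ r))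
tradeAfter []       = fzero , fsuc fzero
tradeAfter (x ∷ xs) = Product.map fsuc fsuc (tradeAfter xs)

tradeAfter-ordered : ∀ xs {u v r} → toℕ (proj₁ (tradeAfter xs {u} {v} {r})) ℕ.< toℕ (proj₂ (tradeAfter xs {u} {v} {r}))
tradeAfter-ordered []       = s≤s z≤n
tradeAfter-ordered (x ∷ xs) = s≤s (tradeAfter-ordered xs)

tradeAfter-valid : ∀ xs {u v r} → ValidSchedule {length (xs ++ u ∷ v ∷ r)} (tradeAfter xs ∷ [])
tradeAfter-valid xs = z≤n , tradeAfter-ordered xs , tt

tradeAfter-buys : ∀ xs {u v r} → lookup (xs ++ u ∷ v ∷ r) (proj₁ (tradeAfter xs)) ≡ u
tradeAfter-buys []       = refl
tradeAfter-buys (x ∷ xs) = tradeAfter-buys xs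

tradeAfter-sells : ∀ xs {u v r} → lookup (xs ++ u ∷ v ∷ r) (proj₂ (tradeAfter xs)) ≡ v
tradeAfter-sells []       = refl
tradeAfter-sells (x ∷ xs) = tradeAfter-sells xs

tradeAfter-return : ∀ xs {u v r} → scheduleReturn (xs ++ u ∷ v ∷ r) (tradeAfter xs ∷ []) ≡ gain u v * 1ℚ
tradeAfter-return xs = cong₂ (λ b s → gain b s * 1ℚ) (tradeAfter-buys xs) (tradeAfter-sells xs)

length-++-∷-pos : ∀ (xs : List ℚ) {x r} → 0 ℕ.< length (xs ++ x ∷ r)
length-++-∷-pos []      = s≤s z≤n
length-++-∷-pos (_ ∷ _) = s≤s z≤n

-- For φ = M / m > 1 we choose
-- ρ = 1 + (φ - 1) / (b φ^b + 1), so that ρ^b ≤ φ, and the rungs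
-- rung k = min (m ρ^k, M): they start at m, grow by a factor at most ρ,
-- and reach M at some rung N.
module Ladder (m M : ℚ) (0<m : 0ℚ < m) (m<M : m < M) (b : ℕ) where

  0≤m : 0ℚ ≤ m
  0≤m = QP.<⇒≤ 0<m

  m≤M : m ≤ M
  m≤M = QP.<⇒≤ m<M

  φ : ℚ
  φ = M ÷' m

  φ*m≡M : φ * m ≡ M
  φ*m≡M = ÷'-*-cancel 0<m M

  1<φ : 1ℚ < φ
  1<φ = QP.*-cancelʳ-<-nonNeg m {{Q.nonNegative 0≤m}}
    (subst₂ _<_ (sym (QP.*-identityˡ m)) (sym φ*m≡M) m<M)

  1≤φ : 1ℚ ≤ φ
  1≤φ = QP.<⇒≤ 1<φ

  1+[φ-1]≡φ : 1ℚ + (φ - 1ℚ) ≡ φ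
  1+[φ-1]≡φ = solve 1 (λ f → con 1ℚ :+ (f :- con 1ℚ) := f) refl φ

  0<φ-1 : 0ℚ < φ - 1ℚ
  0<φ-1 = subst (_< φ - 1ℚ) (QP.+-inverseʳ 1ℚ) (QP.+-monoˡ-< (Q.- 1ℚ) 1<φ)

  D : ℚ
  D = ι b * φ ^ b + 1ℚ

  1≤D : 1ℚ ≤ D
  1≤D = QP.≤-trans (QP.≤-reflexive (sym (QP.+-identityˡ 1ℚ)))
    (QP.+-monoˡ-≤ 1ℚ (*-nonNeg (ι-nonNeg b) (^-nonNeg b (QP.≤-trans 0≤1 1≤φ))))

  0<D : 0ℚ < D
  0<D = QP.<-≤-trans 0<1 1≤D

  h : ℚ
  h = (φ - 1ℚ) ÷' D

  h*D≡φ-1 : h * D ≡ φ - 1ℚ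
  h*D≡φ-1 = ÷'-*-cancel 0<D (φ - 1ℚ)

  0<h : 0ℚ < h
  0<h = ÷'-pos 0<D 0<φ-1

  0≤h : 0ℚ ≤ h
  0≤h = QP.<⇒≤ 0<h

  ρ : ℚ
  ρ = 1ℚ + h

  1≤ρ : 1ℚ ≤ ρ
  1≤ρ = ≤-+-nonNeg 1ℚ 0≤h

  0≤ρ : 0ℚ ≤ ρ
  0≤ρ = QP.≤-trans 0≤1 1≤ρ

  ρ≤φ : ρ ≤ φ
  ρ≤φ = begin
    1ℚ + h          ≡⟨ cong (1ℚ +_) (sym (QP.*-identityʳ h)) ⟩
    1ℚ + h * 1ℚ     ≤⟨ QP.+-monoʳ-≤ 1ℚ (*-monoˡ-≤ 0≤h 1≤D) ⟩
    1ℚ + h * D      ≡⟨ cong (1ℚ +_) h*D≡φ-1 ⟩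
    1ℚ + (φ - 1ℚ)   ≡⟨ 1+[φ-1]≡φ ⟩
    φ               ∎
    where open QP.≤-Reasoning

  ρ^b≤φ : ρ ^ b ≤ φ
  ρ^b≤φ = begin
    ρ ^ b                   ≤⟨ bernoulli-reverse b 0≤h ρ≤φ ⟩
    1ℚ + ι b * (h * φ ^ b)  ≡⟨ cong (1ℚ +_) (solve 3 (λ i h F → i :* (h :* F) := h :* (i :* F)) refl (ι b) h (φ ^ b)) ⟩
    1ℚ + h * (ι b * φ ^ b)  ≤⟨ QP.+-monoʳ-≤ 1ℚ (*-monoˡ-≤ 0≤h (≤-+-nonNeg (ι b * φ ^ b) 0≤1)) ⟩
    1ℚ + h * D              ≡⟨ cong (1ℚ +_) h*D≡φ-1 ⟩
    1ℚ + (φ - 1ℚ)           ≡⟨ 1+[φ-1]≡φ ⟩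
    φ                       ∎
    where open QP.≤-Reasoning

  -- Number of rungs needed to climb from m to M: by Bernoulli, ρ^N ≥ φ as
  -- soon as N h ≥ φ - 1.
  N : ℕ
  N = proj₁ (archimedean ((φ - 1ℚ) ÷' h))

  φ≤ρ^N : φ ≤ ρ ^ N
  φ≤ρ^N = begin
    φ                           ≡⟨ sym 1+[φ-1]≡φ ⟩
    1ℚ + (φ - 1ℚ)               ≡⟨ cong (1ℚ +_) (sym (÷'-*-cancel 0<h (φ - 1ℚ))) ⟩
    1ℚ + ((φ - 1ℚ) ÷' h) * h    ≤⟨ QP.+-monoʳ-≤ 1ℚ (*-monoʳ-≤ 0≤h (proj₂ (archimedean ((φ - 1ℚ) ÷' h)))) ⟩
    1ℚ + ι N * h                ≤⟨ bernoulli N 0≤h ⟩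
    ρ ^ N                       ∎
    where open QP.≤-Reasoning

  rung : ℕ → ℚ
  rung k = (m * ρ ^ k) ⊓ M

  rung-inRange : ∀ k → InRange m M (rung k)
  rung-inRange k = QP.⊓-glb m≤mρᵏ m≤M , QP.p⊓q≤q (m * ρ ^ k) M
    where
    m≤mρᵏ : m ≤ m * ρ ^ k
    m≤mρᵏ = QP.≤-trans (QP.≤-reflexive (sym (QP.*-identityʳ m))) (*-monoˡ-≤ 0≤m (1≤^ k 1≤ρ))

  rung-base : rung 0 ≡ m
  rung-base = trans (cong (_⊓ M) (QP.*-identityʳ m)) (QP.p≤q⇒p⊓q≡p m≤M)

  rung-top : rung N ≡ M
  rung-top = QP.p≥q⇒p⊓q≡q (begin
    M          ≡⟨ trans (sym φ*m≡M) (QP.*-comm φ m) ⟩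
    m * φ      ≤⟨ *-monoˡ-≤ 0≤m φ≤ρ^N ⟩
    m * ρ ^ N  ∎)
    where open QP.≤-Reasoning

  rung-step : ∀ k → rung (suc k) ≤ ρ * rung k
  rung-step k = begin
    (m * (ρ * ρ ^ k)) ⊓ M        ≤⟨ QP.⊓-mono-≤ (QP.≤-reflexive (solve 3 (λ m r R → m :* (r :* R) := r :* (m :* R)) refl m ρ (ρ ^ k)))
                                                 (≤-*-≥1 1≤ρ (QP.≤-trans 0≤m m≤M)) ⟩
    (ρ * (m * ρ ^ k)) ⊓ (ρ * M)  ≡⟨ sym (QP.*-distribˡ-⊓-nonNeg ρ {{Q.nonNegative 0≤ρ}} (m * ρ ^ k) M) ⟩
    ρ * rung k                   ∎
    where open QP.≤-Reasoning

LowerBoundWitness : (m M : ℚ) (a b : ℕ) (A : Alg) → Set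
LowerBoundWitness m M a b A =
  Σ (List ℚ) (λ ps → (0 ℕ.< length ps) × All (InRange m M) ps ×
    Σ (Schedule ps) (λ σ → ValidSchedule σ × (length σ ℕ.≤ 1) ×
      AtLeastPow (M ÷' m) a b (scheduleReturn ps σ ÷' onlineReturn 1 A ps)))

module Adversary (m M : ℚ) (0<m : 0ℚ < m) (m<M : m < M) (a b : ℕ) (0<a : 0 ℕ.< a) (A : Alg) where

  open Ladder m M 0<m m<M b
  open Simulation A

  Witness : Set
  Witness = LowerBoundWitness m M a b A

  m∈ : InRange m M m
  m∈ = QP.≤-refl , m≤M

  M∈ : InRange m M M
  M∈ = m≤M , QP.≤-refl

  0<M : 0ℚ < M
  0<M = QP.<-trans 0<m m<M

  inRange-pos : ∀ {p} → InRange m M p → 0ℚ < p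
  inRange-pos (m≤p , _) = QP.<-≤-trans 0<m m≤p

  -- If OPT earns O with O q = M and A earns N with N p = m, where q ≤ ρ p,
  -- then φ m = O q ≤ (O / N) ρ (N p) = (O / N) ρ m, so O / N ≥ φ / ρ, which
  -- is enough for the target bound because ρ^b ≤ φ.
  refutation : (ps : List ℚ) → 0 ℕ.< length ps → All (InRange m M) ps →
               (σ : Schedule ps) → ValidSchedule σ → length σ ℕ.≤ 1 →
               ∀ {O N p q} → scheduleReturn ps σ ≡ O → onlineReturn 1 A ps ≡ N →
               0ℚ < N → 0ℚ ≤ O → N * p ≡ m → O * q ≡ M → q ≤ ρ * p → Witness
  refutation ps nonEmpty rng σ valid oneTrade {O} {N} {p} {q} opt onl 0<N 0≤O Np≡m Oq≡M q≤ρp =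
    ps , nonEmpty , rng , σ , valid , oneTrade ,
    subst₂ (λ o n → AtLeastPow φ a b (o ÷' n)) (sym opt) (sym onl)
      (atLeastPow-intro a b 0<a 1≤φ ρ^b≤φ (÷'-nonNeg 0<N 0≤O) φ≤Rρ)
    where
    R : ℚ
    R = O ÷' N
    φ≤Rρ : φ ≤ R * ρ
    φ≤Rρ = QP.*-cancelʳ-≤-pos m {{Q.positive 0<m}} (begin
      φ * m               ≡⟨ φ*m≡M ⟩
      M                   ≡⟨ sym Oq≡M ⟩
      O * q               ≤⟨ *-monoˡ-≤ 0≤O q≤ρp ⟩
      O * (ρ * p)         ≡⟨ cong (_* (ρ * p)) (sym (÷'-*-cancel 0<N O)) ⟩
      (R * N) * (ρ * p)   ≡⟨ solve 4 (λ R N r p → (R :* N) :* (r :* p) := (R :* r) :* (N :* p)) refl R N ρ p ⟩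
      (R * ρ) * (N * p)   ≡⟨ cong ((R * ρ) *_) Np≡m ⟩
      (R * ρ) * m         ∎)
      where open QP.≤-Reasoning

  tradeToTop-*-cancel : ∀ {q} → 0ℚ < q → (gain q M * 1ℚ) * q ≡ M
  tradeToTop-*-cancel {q} 0<q = trans (cong (_* q) (QP.*-identityʳ (gain q M))) (÷'-*-cancel 0<q M)

  crash : ∀ {s p} → Idle s → All (InRange m M) s → InRange m M p → M ≤ ρ * p →
          A (s ++ [ p ]) false ≡ true → Witness
  crash {s} {p} idle rng p∈ M≤ρp bought =
    refutation (s ++ p ∷ m ∷ []) (length-++-∷-pos s) (++⁺ rng (p∈ ∷ m∈ ∷ [])) [] tt z≤n
      {1ℚ} {gain p m} {p} {M}
      refl (trans (idle p m []) (buy m [] bought)) (÷'-pos (inRange-pos p∈) 0<m) 0≤1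
      (÷'-*-cancel (inRange-pos p∈) m) (QP.*-identityˡ M) M≤ρp

  missedLast : ∀ {s q} → Idle s → All (InRange m M) s → InRange m M q → q ≤ ρ * m →
               A (s ++ [ q ]) false ≡ false → A ((s ++ [ q ]) ++ [ M ]) false ≡ false → Witness
  missedLast {s} {q} idle rng q∈ q≤ρm declinedQ declinedM =
    refutation (s ++ q ∷ M ∷ M ∷ []) (length-++-∷-pos s) (++⁺ rng (q∈ ∷ M∈ ∷ M∈ ∷ []))
      (tradeAfter s ∷ []) (tradeAfter-valid s) (s≤s z≤n)
      {gain q M * 1ℚ} {1ℚ} {m} {q}
      (tradeAfter-return s) online
      0<1 (*-nonNeg (÷'-nonNeg 0<q (QP.<⇒≤ 0<M)) 0≤1)
      (QP.*-identityˡ m) (tradeToTop-*-cancel 0<q) q≤ρm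
    where
    0<q : 0ℚ < q
    0<q = inRange-pos q∈
    online : onlineReturn 1 A (s ++ q ∷ M ∷ M ∷ []) ≡ 1ℚ
    online = begin
      onlineReturn 1 A (s ++ q ∷ M ∷ M ∷ [])           ≡⟨ idle q M (M ∷ []) ⟩
      run A 1 nothing s (q ∷ M ∷ M ∷ [])               ≡⟨ decline M (M ∷ []) declinedQ ⟩
      run A 1 nothing (s ++ [ q ]) (M ∷ M ∷ [])        ≡⟨ decline M [] declinedM ⟩
      run A 1 nothing ((s ++ [ q ]) ++ [ M ]) (M ∷ []) ∎
      where open ≡-Reasoning

  missedRise : ∀ {s q p} → Idle s → All (InRange m M) s → InRange m M q → InRange m M p → q ≤ ρ * p →
               A (s ++ [ q ]) false ≡ false → A ((s ++ [ q ]) ++ [ M ]) false ≡ false →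
               A (((s ++ [ q ]) ++ [ M ]) ++ [ p ]) false ≡ true → Witness
  missedRise {s} {q} {p} idle rng q∈ p∈ q≤ρp declinedQ declinedM bought =
    refutation (s ++ q ∷ M ∷ p ∷ m ∷ []) (length-++-∷-pos s) (++⁺ rng (q∈ ∷ M∈ ∷ p∈ ∷ m∈ ∷ []))
      (tradeAfter s ∷ []) (tradeAfter-valid s) (s≤s z≤n)
      {gain q M * 1ℚ} {gain p m} {p} {q}
      (tradeAfter-return s) online
      (÷'-pos (inRange-pos p∈) 0<m) (*-nonNeg (÷'-nonNeg 0<q (QP.<⇒≤ 0<M)) 0≤1)
      (÷'-*-cancel (inRange-pos p∈) m) (tradeToTop-*-cancel 0<q) q≤ρp
    where
    0<q : 0ℚ < q
    0<q = inRange-pos q∈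
    online : onlineReturn 1 A (s ++ q ∷ M ∷ p ∷ m ∷ []) ≡ gain p m
    online = begin
      onlineReturn 1 A (s ++ q ∷ M ∷ p ∷ m ∷ [])                ≡⟨ idle q M (p ∷ m ∷ []) ⟩
      run A 1 nothing s (q ∷ M ∷ p ∷ m ∷ [])                    ≡⟨ decline M (p ∷ m ∷ []) declinedQ ⟩
      run A 1 nothing (s ++ [ q ]) (M ∷ p ∷ m ∷ [])             ≡⟨ decline p (m ∷ []) declinedM ⟩
      run A 1 nothing ((s ++ [ q ]) ++ [ M ]) (p ∷ m ∷ [])      ≡⟨ buy m [] bought ⟩
      run A 0 (just p) (((s ++ [ q ]) ++ [ M ]) ++ [ p ]) (m ∷ []) ∎
      where open ≡-Reasoning

  -- The descent: A, idle so far, has just declined rung k.  Offer M; if A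
  -- declines it too, offer rung (k - 1), or end the sequence at rung 0.
  descend : ∀ k {s} → Idle s → All (InRange m M) s → A (s ++ [ rung k ]) false ≡ false → Witness
  descend k {s} idle rng declined with A ((s ++ [ rung k ]) ++ [ M ]) false in answerM
  ... | true = crash (idle-extend idle declined) (++⁺ rng (rung-inRange k ∷ [])) M∈
                     (≤-*-≥1 1≤ρ (QP.<⇒≤ 0<M)) answerM
  descend zero idle rng declined | false =
    missedLast idle rng (rung-inRange 0) (QP.≤-trans (QP.≤-reflexive rung-base) (≤-*-≥1 1≤ρ 0≤m)) declined answerM
  descend (suc k) {s} idle rng declined | false
    with A (((s ++ [ rung (suc k) ]) ++ [ M ]) ++ [ rung k ]) false in answerNext
  ... | true  = missedRise idle rng (rung-inRange (suc k)) (rung-inRange k) (rung-step k) declined answerM answerNext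
  ... | false = descend k (idle-extend (idle-extend idle declined) answerM)
                  (++⁺ (++⁺ rng (rung-inRange (suc k) ∷ [])) (M∈ ∷ [])) answerNext

  adversary : Witness
  adversary with A [ rung N ] false in answerFirst
  ... | true  = crash idle-[] [] (rung-inRange N)
                  (QP.≤-trans (QP.≤-reflexive (sym rung-top)) (≤-*-≥1 1≤ρ (QP.<⇒≤ (inRange-pos (rung-inRange N))))) answerFirst
  ... | false = descend N idle-[] [] answerFirst

-- The main theorem.
theorem1 : (m M : ℚ) → 0ℚ Data.Rational.< m → m < M →
    (a b : ℕ) → 0 Data.Nat.< a → 0 Data.Nat.< b →
    (A : Alg) →
    Σ (List ℚ) (λ ps → (0 Data.Nat.< length ps) × All (InRange m M) ps ×
      Σ (Schedule ps) (λ σ → ValidSchedule σ × (length σ Data.Nat.≤ 1) ×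
        AtLeastPow (M ÷' m) a b (scheduleReturn ps σ ÷' onlineReturn 1 A ps)))
theorem1 m M 0<m m<M a b 0<a _ A = Adversary.adversary m M 0<m m<M a b 0<a A
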